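{- Let $(P,\le,0,1)$ be a bounded poset satisfying the ACC and the DCC. Define binary operators $\sqcup,\sqcap$ on $P$ by $x\sqcup y:=\operatorname{Min}U(x,y)$ and $x\sqcap y:=\operatorname{Max}L(x,y)$, extended to subsets $A,B\subseteq P$ by $A\sqcup B:=\operatorname{Min}U(A\cup B)$ and $A\sqcap B:=\operatorname{Max}L(A\cup B)$ (elements being identified with singletons). Then $(P,\sqcup,\sqcap,0,1)$ is an operator structure.
   Context: ACC/DCC: no infinite strictly ascending/descending chains. For $A\subseteq P$: $L(A)=\{x\mid x\le a\ \forall a\in A\}$, $U(A)=\{x\mid a\le x\ \forall a\in A\}$, $\operatorname{Max}$, $\operatorname{Min}$ denote sets of maximal/minimal elements; $L(x,y)=L(\{x,y\})$, $\operatorname{Max}L(x,y)=\operatorname{Max}(L(\{x,y\}))$, etc. A binary operator on $P$ assigns to each pair of elements (and, by extension, to each pair of subsets) a subset of $P$; elements are identified with singletons, so e.g. "$x\sqcup y=y$" means $x\sqcup y=\{y\}$. An operator structure is $(P,\sqcup,\sqcap,0,1)$ with binary operators $\sqcup,\sqcap$ on $P$ and $0,1\in P$ such that for all $x,y,z\in P$: (i) $x\sqcup x=x$ and $x\sqcap x=x$; (ii) $x\sqcup y=y\sqcup x$ and $x\sqcap y=y\sqcap x$; (iii) $0\sqcup x=x$ and $x\sqcap 1=x$; (iv) $x\sqcup((x\sqcup y)\sqcup z)=0\sqcup((x\sqcup y)\sqcup z)$ and $x\sqcap((x\sqcap y)\sqcap z)=((x\sqcap y)\sqcap z)\sqcap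 1$; (v) $(x\sqcap y)\sqcup y=y$ and $x\sqcap(x\sqcup y)=x$; (vi) $z\in x\sqcup y$ if and only if [$x\sqcup z=y\sqcup z=z$, and for every $u\in P$ with $x\sqcup u=y\sqcup u=u\sqcap z=u$ we have $u=z$]; and $z\in x\sqcap y$ if and only if [$z\sqcap x=z\sqcap y=z$, and for every $u\in P$ with $u\sqcap x=u\sqcap y=z\sqcup u=u$ we have $u=z$]. -}

module Defs where

open import Level using (Level)
open import Data.Nat using (ℕ; suc)
open import Data.Product using (Σ; _×_)
open import Relation.Nullary using (¬_)
open import Relation.Binary using (Rel; IsPartialOrder)
open import Relation.Binary.PropositionalEquality using (_≡_; _≢_)
open import Relation.Unary using (Pred; _∈_; _∪_; _≐_; ｛_｝)
open import Function.Bundles using (_⇔_)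

module _ {a : Level} {P : Set a} (_≤_ : Rel P a) where

  _<_ : Rel P a
  x < y = (x ≤ y) × (x ≢ y)

  ACC : Set a
  ACC = ¬ (Σ (ℕ → P) λ f → ∀ n → f n < f (suc n))

  DCC : Set a
  DCC = ¬ (Σ (ℕ → P) λ f → ∀ n → f (suc n) < f n)

  U : Pred P a → Pred P a
  U A x = ∀ {y} → y ∈ A → y ≤ x

  L : Pred P a → Pred P a
  L A x = ∀ {y} → y ∈ A → x ≤ y

  Min : Pred P a → Pred P a
  Min A x = (x ∈ A) × (∀ {y} → y ∈ A → y ≤ x → y ≡ x)

  Max : Pred P a → Pred P a
  Max A x = (x ∈ A) × (∀ {y} → y ∈ A → x ≤ y → y ≡ x)

  join : Pred P a → Pred P a → Pred P a
  join A B = Min (U (A ∪ B))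

  meet : Pred P a → Pred P a → Pred P a
  meet A B = Max (L (A ∪ B))

-- Operator structure (P, ⊔, ⊓, 0, 1). Binary operators are given on
-- subsets; an element x is identified with the singleton ｛ x ｝.
record IsOperatorStructure {a : Level} {P : Set a}
         (_⊔_ _⊓_ : Pred P a → Pred P a → Pred P a) (𝟘 𝟙 : P) : Set (Level.suc a) where
  field
    idem-⊔ : ∀ x → (｛ x ｝ ⊔ ｛ x ｝) ≐ ｛ x ｝
    idem-⊓ : ∀ x → (｛ x ｝ ⊓ ｛ x ｝) ≐ ｛ x ｝
    comm-⊔ : ∀ x y → (｛ x ｝ ⊔ ｛ y ｝) ≐ (｛ y ｝ ⊔ ｛ x ｝)
    comm-⊓ : ∀ x y → (｛ x ｝ ⊓ ｛ y ｝) ≐ (｛ y ｝ ⊓ ｛ x ｝)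
    unit-⊔ : ∀ x → (｛ 𝟘 ｝ ⊔ ｛ x ｝) ≐ ｛ x ｝
    unit-⊓ : ∀ x → (｛ x ｝ ⊓ ｛ 𝟙 ｝) ≐ ｛ x ｝
    assoc-⊔ : ∀ x y z →
      (｛ x ｝ ⊔ ((｛ x ｝ ⊔ ｛ y ｝) ⊔ ｛ z ｝)) ≐ (｛ 𝟘 ｝ ⊔ ((｛ x ｝ ⊔ ｛ y ｝) ⊔ ｛ z ｝))
    assoc-⊓ : ∀ x y z →
      (｛ x ｝ ⊓ ((｛ x ｝ ⊓ ｛ y ｝) ⊓ ｛ z ｝)) ≐ (((｛ x ｝ ⊓ ｛ y ｝) ⊓ ｛ z ｝) ⊓ ｛ 𝟙 ｝)
    absorb-⊔ : ∀ x y → ((｛ x ｝ ⊓ ｛ y ｝) ⊔ ｛ y ｝) ≐ ｛ y ｝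
    absorb-⊓ : ∀ x y → (｛ x ｝ ⊓ (｛ x ｝ ⊔ ｛ y ｝)) ≐ ｛ x ｝
    char-⊔ : ∀ x y z →
      (z ∈ (｛ x ｝ ⊔ ｛ y ｝)) ⇔
      ( ((｛ x ｝ ⊔ ｛ z ｝) ≐ ｛ z ｝) × ((｛ y ｝ ⊔ ｛ z ｝) ≐ ｛ z ｝)
      × (∀ u → (｛ x ｝ ⊔ ｛ u ｝) ≐ ｛ u ｝ → (｛ y ｝ ⊔ ｛ u ｝) ≐ ｛ u ｝
               → (｛ u ｝ ⊓ ｛ z ｝) ≐ ｛ u ｝ → u ≡ z) )
    char-⊓ : ∀ x y z →
      (z ∈ (｛ x ｝ ⊓ ｛ y ｝)) ⇔
      ( ((｛ z ｝ ⊓ ｛ x ｝) ≐ ｛ z ｝) × ((｛ z ｝ ⊓ ｛ y ｝) ≐ ｛ z ｝)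
      × (∀ u → (｛ u ｝ ⊓ ｛ x ｝) ≐ ｛ u ｝ → (｛ u ｝ ⊓ ｛ y ｝) ≐ ｛ u ｝
               → (｛ z ｝ ⊔ ｛ u ｝) ≐ ｛ u ｝ → u ≡ z) )

-- Both x ⊔ z = z and x ⊓ z = x just say x ≤ z, so every axiom except associativity is a
-- statement about the order alone. Associativity needs x ⊔ y and (x ⊔ y) ⊔ z to be
-- nonempty: under DCC (with excluded middle) every inhabited set, here U(A) ∋ 1, has a
-- minimal element. The meet laws are the join laws of the opposite order, since Max L
-- with respect to ≤ is literally Min U with respect to ≥, and ACC for ≤ is DCC for ≥.
module Submission where

open import Defs
open import Level using (Level)
open import Axiom.ExcludedMiddle using (ExcludedMiddle)
open import Relation.Binary using (Rel; IsPartialOrder)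
open import Relation.Binary.PropositionalEquality using (_≡_; _≢_; refl; sym)
open import Relation.Binary.Construct.Flip.EqAndOrd as Flip using ()
open import Data.Nat using (ℕ; zero; suc)
open import Data.Product using (Σ; _×_; _,_; proj₁; proj₂)
open import Data.Sum using (_⊎_; inj₁; inj₂; swap)
open import Data.Empty using (⊥-elim)
open import Function using (flip; _∘_)
open import Function.Bundles using (_⇔_; mk⇔; Equivalence)
open import Relation.Nullary using (yes; no)
open import Relation.Unary using (Pred; _∈_; _∪_; _≐_; _⊆_; ｛_｝)
open import Relation.Unary.Properties using (≐-trans; ≐-sym)

open Equivalence using (to; from)

module _ {a : Level} {P : Set a} {_≤_ : Rel P a} where

  Min-resp-≐ : {S T : Pred P a} → S ≐ T → Min _≤_ S ≐ Min _≤_ T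
  Min-resp-≐ (S⊆T , T⊆S) =
    (λ (x∈S , min) → S⊆T x∈S , min ∘ T⊆S) , (λ (x∈T , min) → T⊆S x∈T , min ∘ S⊆T)

  ACC⇒DCC-flip : ACC _≤_ → DCC (flip _≤_)
  ACC⇒DCC-flip acc (f , desc) = acc (f , λ n → proj₁ (desc n) , proj₂ (desc n) ∘ sym)

  module _ (em : ExcludedMiddle a) where

    smaller-or-minimal : {S : Pred P a} {w : P} → w ∈ S →
      (Σ P λ y → y ∈ S × y ≤ w × y ≢ w) ⊎ w ∈ Min _≤_ S
    smaller-or-minimal {S} {w} w∈S with em {Σ P λ y → y ∈ S × y ≤ w × y ≢ w}
    ... | yes smaller = inj₁ smaller
    ... | no ∄smaller = inj₂ (w∈S , minimal)
      where
      minimal : ∀ {y} → y ∈ S → y ≤ w → y ≡ w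
      minimal {y} y∈S y≤w with em {y ≡ w}
      ... | yes y≡w = y≡w
      ... | no y≢w = ⊥-elim (∄smaller (y , y∈S , y≤w , y≢w))

    Min-nonempty : DCC _≤_ → {S : Pred P a} {z : P} → z ∈ S → Σ P (Min _≤_ S)
    Min-nonempty dcc {S} {z} z∈S with em {Σ P (Min _≤_ S)}
    ... | yes m = m
    ... | no ∄min = ⊥-elim (dcc (proj₁ ∘ chain , λ n → proj₂ (step (chain n))))
      where
      step : (w : Σ P S) → Σ (Σ P S) λ v → proj₁ v ≤ proj₁ w × proj₁ v ≢ proj₁ w
      step (w , w∈S) with smaller-or-minimal w∈S
      ... | inj₁ (y , y∈S , y<w) = (y , y∈S) , y<w
      ... | inj₂ w-min = ⊥-elim (∄min (w , w-min))

      chain : ℕ → Σ P S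
      chain zero = z , z∈S
      chain (suc n) = proj₁ (step (chain n))

module JoinProperties {a : Level} {P : Set a} {_≤_ : Rel P a}
                      (po : IsPartialOrder _≡_ _≤_) where

  open IsPartialOrder po using (antisym) renaming (refl to ≤-refl; trans to ≤-trans)

  _⊔_ : Pred P a → Pred P a → Pred P a
  _⊔_ = join _≤_

  Min-least : {S : Pred P a} {y : P} → y ∈ S → (∀ {t} → t ∈ S → y ≤ t) → Min _≤_ S ≐ ｛ y ｝
  Min-least y∈S least =
    (λ (t∈S , min) → min y∈S (least t∈S)) ,
    (λ { refl → y∈S , λ t∈S t≤y → antisym t≤y (least t∈S) })

  U-pair⇔ : {x y z : P} → U _≤_ (｛ x ｝ ∪ ｛ y ｝) z ⇔ (x ≤ z × y ≤ z)
  U-pair⇔ = mk⇔ (λ u → u (inj₁ refl) , u (inj₂ refl))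
                (λ { (x≤z , y≤z) (inj₁ refl) → x≤z ; (x≤z , y≤z) (inj₂ refl) → y≤z })

  join-comm : (A B : Pred P a) → (A ⊔ B) ≐ (B ⊔ A)
  join-comm A B = Min-resp-≐ (U-swap , U-swap)
    where
    U-swap : {C D : Pred P a} → U _≤_ (C ∪ D) ⊆ U _≤_ (D ∪ C)
    U-swap u = u ∘ swap

  join-≐ʳ : {A : Pred P a} {y : P} → U _≤_ A y → (A ⊔ ｛ y ｝) ≐ ｛ y ｝
  join-≐ʳ y-upper = Min-least (λ { (inj₁ a∈A) → y-upper a∈A ; (inj₂ refl) → ≤-refl })
                              (λ u → u (inj₂ refl))

  join-≐ˡ : {B : Pred P a} {x : P} → U _≤_ B x → (｛ x ｝ ⊔ B) ≐ ｛ x ｝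
  join-≐ˡ {B} {x} x-upper = ≐-trans (join-comm ｛ x ｝ B) (join-≐ʳ x-upper)

  join-singleton-≐ʳ⇔ : {x z : P} → ((｛ x ｝ ⊔ ｛ z ｝) ≐ ｛ z ｝) ⇔ (x ≤ z)
  join-singleton-≐ʳ⇔ = mk⇔ (λ (_ , ⊇) → proj₁ (⊇ refl) (inj₁ refl))
                           (λ x≤z → join-≐ʳ λ { refl → x≤z })

  join-singleton-≐ˡ⇔ : {x z : P} → ((｛ z ｝ ⊔ ｛ x ｝) ≐ ｛ z ｝) ⇔ (x ≤ z)
  join-singleton-≐ˡ⇔ = mk⇔ (λ (_ , ⊇) → proj₁ (⊇ refl) (inj₂ refl))
                           (λ x≤z → join-≐ˡ λ { refl → x≤z })

  -- R and S are any two encodings of the order, such as x ⊔ z = z and x ⊓ z = x.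
  join-pair⇔ : (R S : Rel P a) → (∀ {u v} → R u v ⇔ u ≤ v) → (∀ {u v} → S u v ⇔ u ≤ v) →
    {x y z : P} → (z ∈ (｛ x ｝ ⊔ ｛ y ｝)) ⇔
      (R x z × R y z × (∀ u → R x u → R y u → S u z → u ≡ z))
  join-pair⇔ R S R⇔≤ S⇔≤ = mk⇔
    (λ (z-upper , min) → let (x≤z , y≤z) = to U-pair⇔ z-upper in
      from R⇔≤ x≤z , from R⇔≤ y≤z ,
      λ u Rxu Ryu Suz → min (from U-pair⇔ (to R⇔≤ Rxu , to R⇔≤ Ryu)) (to S⇔≤ Suz))
    (λ (Rxz , Ryz , min) →
      from U-pair⇔ (to R⇔≤ Rxz , to R⇔≤ Ryz) ,
      λ {u} u-upper u≤z → let (x≤u , y≤u) = to U-pair⇔ u-upper in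
        min u (from R⇔≤ x≤u) (from R⇔≤ y≤u) (from S⇔≤ u≤z))

  U-∪-below : {S : Pred P a} {x s : P} → s ∈ S → x ≤ s → U _≤_ (｛ x ｝ ∪ S) ≐ U _≤_ S
  U-∪-below s∈S x≤s =
    (λ u → u ∘ inj₂) ,
    (λ { u (inj₁ refl) → ≤-trans x≤s (u s∈S) ; u (inj₂ t∈S) → u t∈S })

  module Bounded (em : ExcludedMiddle a) (dcc : DCC _≤_) {𝟘 𝟙 : P}
                 (bottom : ∀ x → 𝟘 ≤ x) (top : ∀ x → x ≤ 𝟙) where

    join-nonempty : (A B : Pred P a) → Σ P (A ⊔ B)
    join-nonempty A B = Min-nonempty em dcc {z = 𝟙} (λ _ → top _)

    -- Some s ∈ (x ⊔ y) ⊔ z lies above x and 𝟘, so adding either to (x ⊔ y) ⊔ z does not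
    -- change its upper bounds.
    join-assoc : ∀ x y z →
      (｛ x ｝ ⊔ ((｛ x ｝ ⊔ ｛ y ｝) ⊔ ｛ z ｝)) ≐ (｛ 𝟘 ｝ ⊔ ((｛ x ｝ ⊔ ｛ y ｝) ⊔ ｛ z ｝))
    join-assoc x y z =
      Min-resp-≐ (≐-trans (U-∪-below s∈S x≤s) (≐-sym (U-∪-below s∈S (bottom s))))
      where
      J : Pred P a
      J = ｛ x ｝ ⊔ ｛ y ｝

      w : P
      w = proj₁ (join-nonempty ｛ x ｝ ｛ y ｝)

      w∈J : w ∈ J
      w∈J = proj₂ (join-nonempty ｛ x ｝ ｛ y ｝)

      s : P
      s = proj₁ (join-nonempty J ｛ z ｝)

      s∈S : s ∈ (J ⊔ ｛ z ｝)
      s∈S = proj₂ (join-nonempty J ｛ z ｝)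

      x≤s : x ≤ s
      x≤s = ≤-trans (proj₁ w∈J (inj₁ refl)) (proj₁ s∈S (inj₁ w∈J))

theorem3p2 : ∀ {a : Level} → ExcludedMiddle a →
    (P : Set a) (_≤_ : Rel P a) (𝟘 𝟙 : P) →
    IsPartialOrder _≡_ _≤_ →
    (∀ x → 𝟘 ≤ x) → (∀ x → x ≤ 𝟙) →
    ACC _≤_ → DCC _≤_ →
    IsOperatorStructure (join _≤_) (meet _≤_) 𝟘 𝟙
theorem3p2 em P _≤_ 𝟘 𝟙 po bottom top acc dcc = record
  { idem-⊔ = λ x → from ≤.join-singleton-≐ʳ⇔ ≤-refl
  ; idem-⊓ = λ x → from ≥.join-singleton-≐ʳ⇔ ≤-refl
  ; comm-⊔ = λ x y → ≤.join-comm ｛ x ｝ ｛ y ｝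
  ; comm-⊓ = λ x y → ≥.join-comm ｛ x ｝ ｛ y ｝
  ; unit-⊔ = λ x → from ≤.join-singleton-≐ʳ⇔ (bottom x)
  ; unit-⊓ = λ x → from ≥.join-singleton-≐ˡ⇔ (top x)
  ; assoc-⊔ = ≤-bounded.join-assoc
  ; assoc-⊓ = λ x y z → ≐-trans (≥-bounded.join-assoc x y z) (≥.join-comm ｛ 𝟙 ｝ _)
  ; absorb-⊔ = λ x y → ≤.join-≐ʳ λ m → proj₁ m (inj₂ refl)
  ; absorb-⊓ = λ x y → ≥.join-≐ˡ λ j → proj₁ j (inj₁ refl)
  ; char-⊔ = λ x y z → ≤.join-pair⇔ (λ u v → join _≤_ ｛ u ｝ ｛ v ｝ ≐ ｛ v ｝)
                                    (λ u v → meet _≤_ ｛ u ｝ ｛ v ｝ ≐ ｛ u ｝)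
                                    ≤.join-singleton-≐ʳ⇔ ≥.join-singleton-≐ˡ⇔
  ; char-⊓ = λ x y z → ≥.join-pair⇔ (λ u v → meet _≤_ ｛ v ｝ ｛ u ｝ ≐ ｛ v ｝)
                                    (λ u v → join _≤_ ｛ v ｝ ｛ u ｝ ≐ ｛ u ｝)
                                    ≥.join-singleton-≐ˡ⇔ ≤.join-singleton-≐ʳ⇔
  }
  where
  open IsPartialOrder po using () renaming (refl to ≤-refl)
  module ≤ = JoinProperties po
  module ≥ = JoinProperties (Flip.isPartialOrder po)
  module ≤-bounded = ≤.Bounded em dcc bottom top
  module ≥-bounded = ≥.Bounded em (ACC⇒DCC-flip {_≤_ = _≤_} acc) top bottom
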